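{- Let $S$ be a numerical semigroup. For all $k\ge 2$, we have $A_k\cap D\subseteq\bigcup_{i,j}(A_i+A_j)$, where the union is over all $i,j$ with $1\le i\le j$ and $k-1\le i+j\le k+1$.
   Context: A numerical semigroup is a submonoid $S$ of $(\mathbb N,+)$ with $\mathbb N\setminus S$ finite; $S^*=S\setminus\{0\}$, $m=\min S^*$, $c$ is the least $c\in\mathbb N$ with $[c,\infty[\subseteq S$, $q=\lceil c/m\rceil$, $\rho=qm-c\in[0,m-1]$. $P$ is the set of elements of $S^*$ not expressible as a sum of two elements of $S^*$, $D=S^*\setminus P=S^*+S^*$. For $j\in\mathbb Z$ let $I_j=[jm-\rho,(j+1)m-\rho-1]$. $A=\{x\in S: x-m\notin S\}$ is the Apéry set with respect to $m$, and $A_i=A\cap I_i$. -}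

module Defs where

open import Data.Nat using (ℕ; zero; suc; _+_; _*_; _∸_; _≤_; _<_)
open import Data.Product using (Σ; ∃; ∃-syntax; _×_; _,_)
open import Relation.Nullary using (¬_)
open import Relation.Binary.PropositionalEquality using (_≡_)

-- A numerical semigroup: a submonoid S of (ℕ,+) whose complement ℕ ∖ S is finite
-- (finiteness of a subset of ℕ expressed as boundedness).
record NumericalSemigroup : Set₁ where
  field
    S       : ℕ → Set
    zero∈   : S 0
    closed  : ∀ {a b} → S a → S b → S (a + b)
    cofinite : ∃[ B ] (∀ n → ¬ S n → n < B)

module _ (NS : NumericalSemigroup) where
  open NumericalSemigroup NS

  S* : ℕ → Set
  S* x = S x × 0 < x

  IsMultiplicity : ℕ → Set
  IsMultiplicity m = S* m × (∀ x → S* x → m ≤ x)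

  IsConductor : ℕ → Set
  IsConductor c = (∀ n → c ≤ n → S n) × (∀ c' → (∀ n → c' ≤ n → S n) → c ≤ c')

  D : ℕ → Set
  D x = ∃[ a ] ∃[ b ] (S* a × S* b × x ≡ a + b)

  -- Apéry set w.r.t. m:  x ∈ S and x - m ∉ S (an integer x - m < 0 is never in S)
  Apery : ℕ → ℕ → Set
  Apery m x = S x × ¬ (∃[ y ] (S y × y + m ≡ x))

IsCeilDiv : ℕ → ℕ → ℕ → Set
IsCeilDiv c m q = c ≤ q * m × (∀ q' → c ≤ q' * m → q ≤ q')

-- x ∈ I_j = [jm - ρ, (j+1)m - ρ - 1]  ⇔  jm ≤ x + ρ < (j+1)m
InI : (m ρ j x : ℕ) → Set
InI m ρ j x = j * m ≤ x + ρ × x + ρ < suc j * m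

-- Write x = a + b with a, b ∈ S*. If a − m were in S then so would be x − m = (a − m) + b,
-- so a and b both lie in the Apéry set, and a ≥ m puts a in some I_i with i ≥ 1. Since
-- I_j = [jm − ρ, (j+1)m − ρ − 1], the sum of an element of I_i and one of I_j lies in
-- [(i+j)m − 2ρ, (i+j+2)m − 2ρ − 2], and ρ < m forces its own index k to satisfy
-- i + j − 1 ≤ k ≤ i + j + 1.
module Submission where

open import Defs
open import Data.Nat using (ℕ; zero; suc; _+_; _*_; _∸_; _≤_; _<_; NonZero; >-nonZero; >-nonZero⁻¹)
open import Data.Nat.Properties
open import Data.Nat.DivMod using (_/_; _%_; m/n*n≤m; m≡m%n+[m/n]*n; m%n<n; /-monoˡ-≤; m≥n⇒m/n>0)
open import Data.Nat.Solver using (module +-*-Solver)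
open import Data.Product using (∃-syntax; _×_; _,_; proj₂)
open import Data.Sum using (inj₁; inj₂)
open import Relation.Binary.PropositionalEquality

module _ (NS : NumericalSemigroup) where
  open NumericalSemigroup NS

  Apery-summandˡ : ∀ {m a b} → S a → S b → Apery NS m (a + b) → Apery NS m a
  Apery-summandˡ {m} {a} {b} a∈S b∈S (_ , a+b∉m+S) = a∈S , λ { (y , y∈S , y+m≡a) →
    a+b∉m+S (y + b , closed y∈S b∈S , (begin
      y + b + m   ≡⟨ +-assoc y b m ⟩
      y + (b + m) ≡⟨ cong (y +_) (+-comm b m) ⟩
      y + (m + b) ≡⟨ +-assoc y m b ⟨
      y + m + b   ≡⟨ cong (_+ b) y+m≡a ⟩
      a + b       ∎)) }
    where open ≡-Reasoning

  Apery-summandʳ : ∀ {m a b} → S a → S b → Apery NS m (a + b) → Apery NS m b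
  Apery-summandʳ {a = a} {b} a∈S b∈S x∈Ap =
    Apery-summandˡ b∈S a∈S (subst (Apery NS _) (+-comm a b) x∈Ap)

ceilDiv-excess<divisor : ∀ {c m q} .{{_ : NonZero m}} → IsCeilDiv c m q → q * m ∸ c < m
ceilDiv-excess<divisor {c} {m} {q} (_ , q-least) = m<n+o⇒m∸n<o (q * m) c (qm<c+m q q-least)
  where
  qm<c+m : ∀ q → (∀ q' → c ≤ q' * m → q ≤ q') → q * m < c + m
  qm<c+m zero    _       = ≤-trans (>-nonZero⁻¹ m) (m≤n+m m c)
  qm<c+m (suc p) q-least = begin-strict
    m + p * m <⟨ +-monoʳ-< m (≰⇒> (λ c≤pm → 1+n≰n (q-least p c≤pm))) ⟩
    m + c     ≡⟨ +-comm m c ⟩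
    c + m     ∎
    where open ≤-Reasoning

module _ (m ρ : ℕ) .{{_ : NonZero m}} where

  index : ℕ → ℕ
  index y = (y + ρ) / m

  InI-index : ∀ y → InI m ρ (index y) y
  InI-index y = m/n*n≤m (y + ρ) m , (begin-strict
    y + ρ                     ≡⟨ m≡m%n+[m/n]*n (y + ρ) m ⟩
    (y + ρ) % m + index y * m <⟨ +-monoˡ-< (index y * m) (m%n<n (y + ρ) m) ⟩
    suc (index y) * m         ∎)
    where open ≤-Reasoning

  index-mono : ∀ {a b} → a ≤ b → index a ≤ index b
  index-mono a≤b = /-monoˡ-≤ m (+-monoˡ-≤ ρ a≤b)

  index-pos : ∀ {y} → m ≤ y → 1 ≤ index y
  index-pos {y} m≤y = m≥n⇒m/n>0 (≤-trans m≤y (m≤m+n y ρ))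

module _ (m ρ : ℕ) where
  open +-*-Solver using (solve; _:+_; _:=_)

  private
    twice-shift : ∀ a b → (a + b + ρ) + ρ ≡ (a + ρ) + (b + ρ)
    twice-shift a b = solve 3 (λ a b ρ → (a :+ b :+ ρ) :+ ρ := (a :+ ρ) :+ (b :+ ρ)) refl a b ρ

  InI-+-lower : ∀ i j {k} a b → InI m ρ i a → InI m ρ j b → InI m ρ k (a + b) →
                k ≤ suc (i + j)
  InI-+-lower i j {k} a b (_ , a<) (_ , b<) (k≤ , _) =
    ≤-pred (*-cancelʳ-< m k (suc (suc (i + j))) (begin-strict
      k * m                     ≤⟨ k≤ ⟩
      a + b + ρ                 ≤⟨ m≤m+n (a + b + ρ) ρ ⟩
      (a + b + ρ) + ρ           ≡⟨ twice-shift a b ⟩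
      (a + ρ) + (b + ρ)         <⟨ +-mono-< a< b< ⟩
      suc i * m + suc j * m     ≡⟨ *-distribʳ-+ m (suc i) (suc j) ⟨
      (suc i + suc j) * m       ≡⟨ cong (λ n → suc n * m) (+-suc i j) ⟩
      suc (suc (i + j)) * m     ∎))
    where open ≤-Reasoning

  InI-+-upper : ∀ i j {k} a b → ρ < m → InI m ρ i a → InI m ρ j b → InI m ρ k (a + b) →
                i + j ≤ suc k
  InI-+-upper i j {k} a b ρ<m (≤a , _) (≤b , _) (_ , <k) =
    ≤-pred (*-cancelʳ-< m (i + j) (suc (suc k)) (begin-strict
      (i + j) * m               ≡⟨ *-distribʳ-+ m i j ⟩
      i * m + j * m             ≤⟨ +-mono-≤ ≤a ≤b ⟩
      (a + ρ) + (b + ρ)         ≡⟨ twice-shift a b ⟨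
      (a + b + ρ) + ρ           <⟨ +-mono-< <k ρ<m ⟩
      suc k * m + m             ≡⟨ +-comm (suc k * m) m ⟩
      suc (suc k) * m           ∎))
    where open ≤-Reasoning

module _ (NS : NumericalSemigroup) (m ρ : ℕ) (m-mult : IsMultiplicity NS m) (ρ<m : ρ < m) where

  AperySplitting : (k x : ℕ) → Set
  AperySplitting k x = ∃[ i ] ∃[ j ] ∃[ a ] ∃[ b ]
    (1 ≤ i × i ≤ j × k ≤ suc (i + j) × i + j ≤ suc k ×
     Apery NS m a × InI m ρ i a ×
     Apery NS m b × InI m ρ j b ×
     x ≡ a + b)

  private
    0<m : 0 < m
    0<m = let ((_ , 0<m) , _) = m-mult in 0<m

    instance
      m≢0 : NonZero m
      m≢0 = >-nonZero 0<m

  Apery-split-ordered : ∀ {k x a b} → a ≤ b → S* NS a → S* NS b → x ≡ a + b →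
                        Apery NS m x → InI m ρ k x → AperySplitting k x
  Apery-split-ordered {a = a} {b} a≤b a∈S*@(a∈S , _) (b∈S , _) refl x∈Ap x∈Ik =
    i , j , a , b ,
    index-pos m ρ (proj₂ m-mult a a∈S*) , index-mono m ρ a≤b ,
    InI-+-lower m ρ i j a b a∈Ii b∈Ij x∈Ik , InI-+-upper m ρ i j a b ρ<m a∈Ii b∈Ij x∈Ik ,
    Apery-summandˡ NS a∈S b∈S x∈Ap , a∈Ii , Apery-summandʳ NS a∈S b∈S x∈Ap , b∈Ij , refl
    where
    i j : ℕ
    i = index m ρ a
    j = index m ρ b
    a∈Ii : InI m ρ i a
    a∈Ii = InI-index m ρ a
    b∈Ij : InI m ρ j b
    b∈Ij = InI-index m ρ b

  Apery-split : ∀ k x → Apery NS m x → InI m ρ k x → D NS x → AperySplitting k x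
  Apery-split k x x∈Ap x∈Ik (a , b , a∈S* , b∈S* , x≡a+b) with ≤-total a b
  ... | inj₁ a≤b = Apery-split-ordered a≤b a∈S* b∈S* x≡a+b x∈Ap x∈Ik
  ... | inj₂ b≤a = Apery-split-ordered b≤a b∈S* a∈S* (trans x≡a+b (+-comm a b)) x∈Ap x∈Ik

proposition2p14 : (NS : NumericalSemigroup) (m c q : ℕ) →
    IsMultiplicity NS m → IsConductor NS c → IsCeilDiv c m q →
    (k : ℕ) → 2 ≤ k → (x : ℕ) →
    Apery NS m x → InI m (q * m ∸ c) k x → D NS x →
    ∃[ i ] ∃[ j ] ∃[ a ] ∃[ b ]
    (1 ≤ i × i ≤ j × k ≤ suc (i + j) × i + j ≤ suc k ×
    Apery NS m a × InI m (q * m ∸ c) i a ×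
    Apery NS m b × InI m (q * m ∸ c) j b ×
    x ≡ a + b)
proposition2p14 NS m c q m-mult@((_ , 0<m) , _) _ ceil k _ =
  Apery-split NS m (q * m ∸ c) m-mult (ceilDiv-excess<divisor ceil) k
  where instance _ = >-nonZero 0<m
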